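{- For every integer $m\ge 3$, \[ \gamma_{oiR}(P_{2}\Box C_{m})=\begin{cases}\lceil \frac{4m}{3}\rceil+1, & m\equiv 3 \text{ or } 5 \pmod 6,\\[2pt] \lceil \frac{4m}{3}\rceil, & \text{otherwise.}\end{cases} \]
   Context: All graphs are simple and undirected. $P_n$ denotes the path on $n$ vertices and $C_m$ the cycle on $m$ vertices; $P_n\Box C_m$ is their Cartesian product, with vertex set $\{v_{i,j}: 0\le i\le n-1,\ 0\le j\le m-1\}$, where $v_{i,j}$ and $v_{i',j'}$ are adjacent iff either $i=i'$ and $j'\equiv j\pm1 \pmod m$, or $j=j'$ and $|i-i'|=1$. For a graph $G=(V,E)$, an outer independent Roman dominating function (OIRDF) is a function $f:V\to\{0,1,2\}$ such that every vertex $u$ with $f(u)=0$ has a neighbour $v$ with $f(v)=2$, and the set $V_0=\{u\in V: f(u)=0\}$ is an independent set (no two vertices with label $0$ are adjacent). The weight of $f$ is $w(f)=\sum_{v\in V}f(v)$, and the outer independent Roman domination number $\gamma_{oiR}(G)$ is the minimum weight of an OIRDF of $G$. -}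

module Defs where

open import Data.Nat using (ℕ; zero; suc; _+_; _*_; _≤_)
open import Data.Nat.DivMod using (_/_; _%_)
open import Data.Fin using (Fin; toℕ)
open import Data.List using (List; map; allFin)
open import Data.Nat.ListAction using (sum)
open import Data.Product using (_×_; Σ; ∃; _,_)
open import Data.Sum using (_⊎_)
open import Relation.Binary.PropositionalEquality using (_≡_)
open import Relation.Nullary using (¬_)

Vertex : ℕ → ℕ → Set
Vertex n m = Fin n × Fin m

data Adj (n m : ℕ) : Vertex n m → Vertex n m → Set where
  cyc+ : ∀ {i j j'} → toℕ j' ≡ (suc (toℕ j)) % suc (m Data.Nat.∸ 1) →
         Adj n m (i , j) (i , j')
  cyc- : ∀ {i j j'} → toℕ j ≡ (suc (toℕ j')) % suc (m Data.Nat.∸ 1) →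
         Adj n m (i , j) (i , j')
  path+ : ∀ {i i' j} → toℕ i' ≡ suc (toℕ i) → Adj n m (i , j) (i' , j)
  path- : ∀ {i i' j} → toℕ i ≡ suc (toℕ i') → Adj n m (i , j) (i' , j)

Labelling : ℕ → ℕ → Set
Labelling n m = Vertex n m → Fin 3

weight : (n m : ℕ) → Labelling n m → ℕ
weight n m f = sum (map (λ i → sum (map (λ j → toℕ (f (i , j))) (allFin m))) (allFin n))

IsOIRDF : (n m : ℕ) → Labelling n m → Set
IsOIRDF n m f =
  (∀ u → toℕ (f u) ≡ 0 → ∃ λ v → Adj n m u v × toℕ (f v) ≡ 2) ×
  (∀ u v → Adj n m u v → toℕ (f u) ≡ 0 → ¬ (toℕ (f v) ≡ 0))

IsγoiR : (n m : ℕ) → ℕ → Set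
IsγoiR n m k =
  (Σ (Labelling n m) λ f → IsOIRDF n m f × weight n m f ≡ k) ×
  (∀ f → IsOIRDF n m f → k ≤ weight n m f)

ceil4m/3 : ℕ → ℕ
ceil4m/3 m = (4 * m + 2) / 3

oiRValue : ℕ → ℕ
oiRValue m with m % 6
... | 3 = ceil4m/3 m + 1
... | 5 = ceil4m/3 m + 1
... | _ = ceil4m/3 m

module Submission where

-- Record a labelling of P₂ □ Cₘ by the cyclic sequence of its columns (f v₀ⱼ , f v₁ⱼ); it is
-- an OIRDF iff every window of three consecutive columns satisfies the OIRDF conditions at
-- the middle column.
--
-- Upper bound: repeat the block (0,1)(2,0)(0,1)(1,0)(0,2)(1,0) of weight 8 and close the
-- cycle with a short tail depending on m mod 6; validity is checked window by window.
--
-- Lower bound: a potential ψ on pairs of consecutive columns, tagged with a parity bit, such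
-- that every valid window (a , b , c) satisfies ψ (b , c , ¬ p) + 4 ≤ 3 w(a) + ψ (a , b , p).
-- Going once around the cycle telescopes to 4m + ψ (end) ≤ 3 w(f) + ψ (start), and the parity
-- bit has flipped iff m is odd. If ψ (x , true) ≥ ψ (x , false) + 2 at the starting pair x this
-- gives 3 w(f) ≥ 4m + 2 (m mod 2). Two explicit potentials cover all starting pairs, and
-- rounding 4m + 2 (m mod 2) up to a multiple of 3 gives exactly the claimed value.

open import Algebra.Properties.CommutativeSemigroup using (interchange)
open import Data.Bool using (Bool; true; false; not)
open import Data.Fin using (Fin; zero; suc; toℕ; combine; #_)
open import Data.Fin.Properties using (all?; toℕ-injective; toℕ-fromℕ<; toℕ<n)
open import Data.List using (List; []; _∷_; _++_; map; length; lookup; tabulate; allFin; applyUpTo)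
open import Data.List.Properties using (map-tabulate; tabulate-cong; tabulate-lookup; length-++)
open import Data.Nat using (ℕ; zero; suc; _+_; _*_; _≤_; _<_; _≤?_; s≤s)
open import Data.Nat.DivMod
open import Data.Nat.Divisibility using (divides; ∣-refl)
open import Data.Nat.ListAction using (sum)
open import Data.Nat.Properties
open import Data.Nat.Tactic.RingSolver using (solve)
open import Data.Product using (_×_; _,_; proj₁; proj₂; ∃; Σ)
open import Data.Sum using (_⊎_; inj₁; inj₂; [_,_]′)
open import Data.Unit using (⊤; tt)
open import Data.Vec using (Vec)
import Data.Vec as Vec
open import Function using (_∘_)
open import Relation.Binary.PropositionalEquality
open import Relation.Nullary.Decidable using (Dec; yes; map′; ¬?; _×-dec_; _⊎-dec_; _→-dec_; from-yes)

open import Defs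

sum-map-+ : ∀ {A : Set} (g h : A → ℕ) xs →
            sum (map (λ x → g x + h x) xs) ≡ sum (map g xs) + sum (map h xs)
sum-map-+ g h [] = refl
sum-map-+ g h (x ∷ xs) =
  trans (cong (g x + h x +_) (sum-map-+ g h xs)) (interchange +-commutativeSemigroup (g x) (h x) _ _)

tabulate-toℕ : ∀ {A : Set} k (h : ℕ → A) → tabulate {n = k} (h ∘ toℕ) ≡ applyUpTo h k
tabulate-toℕ zero h = refl
tabulate-toℕ (suc k) h = cong (h 0 ∷_) (tabulate-toℕ k (h ∘ suc))

-- Windows of three consecutive columns

Column : Set
Column = Fin 3 × Fin 3

row : Fin 2 → Column → Fin 3
row zero = proj₁
row (suc zero) = proj₂

otherRow : Fin 2 → Fin 2
otherRow zero = suc zero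
otherRow (suc zero) = zero

columnWeight : Column → ℕ
columnWeight (x , y) = toℕ x + toℕ y

-- The OIRDF conditions at a vertex labelled x whose neighbours in its own row are labelled
-- l and r, and whose neighbour in the other row is labelled o.
LocalOIR : (l x r o : Fin 3) → Set
LocalOIR l x r o =
  toℕ x ≡ 0 → (toℕ l ≢ 0 × toℕ r ≢ 0 × toℕ o ≢ 0) × (toℕ l ≡ 2 ⊎ toℕ r ≡ 2 ⊎ toℕ o ≡ 2)

localOIR? : ∀ l x r o → Dec (LocalOIR l x r o)
localOIR? l x r o =
  toℕ x ≟ 0 →-dec (¬? (toℕ l ≟ 0) ×-dec ¬? (toℕ r ≟ 0) ×-dec ¬? (toℕ o ≟ 0))
                  ×-dec (toℕ l ≟ 2 ⊎-dec toℕ r ≟ 2 ⊎-dec toℕ o ≟ 2)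

ValidWindow : Column → Column → Column → Set
ValidWindow a b c = ∀ r → LocalOIR (row r a) (row r b) (row r c) (row (otherRow r) b)

validWindow? : ∀ a b c → Dec (ValidWindow a b c)
validWindow? a b c = all? λ r → localOIR? (row r a) (row r b) (row r c) (row (otherRow r) b)

ValidWindow-cong : ∀ {a b c a′ b′ c′} → a ≡ a′ → b ≡ b′ → c ≡ c′ →
                   ValidWindow a b c → ValidWindow a′ b′ c′
ValidWindow-cong refl refl refl v = v

ValidWindows : (ℕ → Column) → Set
ValidWindows c = ∀ j → ValidWindow (c j) (c (suc j)) (c (suc (suc j)))

∀-column? : {P : Column → Set} → (∀ c → Dec (P c)) → Dec (∀ c → P c)
∀-column? P? =
  map′ (λ h c → h (proj₁ c) (proj₂ c)) (λ h x y → h (x , y)) (all? λ x → all? λ y → P? (x , y))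

∀-bool? : {P : Bool → Set} → (∀ p → Dec (P p)) → Dec (∀ p → P p)
∀-bool? {P} P? = map′ both (λ h → h false , h true) (P? false ×-dec P? true)
  where
  both : P false × P true → ∀ p → P p
  both (f , _) false = f
  both (_ , t) true = t

-- The potential argument

Potential : Set
Potential = Column → Column → Bool → ℕ

IsPotential : Potential → Set
IsPotential ψ = ∀ a b c p → ValidWindow a b c → ψ b c (not p) + 4 ≤ 3 * columnWeight a + ψ a b p

OddGap : Potential → Column → Column → Set
OddGap ψ a b = ψ a b false + 2 ≤ ψ a b true

parityAfter : ℕ → Bool → Bool
parityAfter zero p = p
parityAfter (suc k) p = parityAfter k (not p)

oddGap-parityAfter : ∀ {ψ a b} → OddGap ψ a b →
                     ∀ k → ψ a b false + 2 * (k % 2) ≤ ψ a b (parityAfter k false)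
oddGap-parityAfter gap zero = ≤-reflexive (+-identityʳ _)
oddGap-parityAfter gap (suc zero) = gap
oddGap-parityAfter {ψ} {a} {b} gap (suc (suc k)) = oddGap-parityAfter {ψ} {a} {b} gap k

telescope-step : ∀ k x s y w z → 4 * k + x ≤ 3 * s + y → y + 4 ≤ 3 * w + z →
                 4 * suc k + x ≤ 3 * (w + s) + z
telescope-step k x s y w z ih step = begin
  4 * suc k + x         ≡⟨ shift ⟩
  (4 * k + x) + 4       ≤⟨ +-monoˡ-≤ 4 ih ⟩
  (3 * s + y) + 4       ≡⟨ +-assoc (3 * s) y 4 ⟩
  3 * s + (y + 4)       ≤⟨ +-monoʳ-≤ (3 * s) step ⟩
  3 * s + (3 * w + z)   ≡⟨ collect ⟩
  3 * (w + s) + z       ∎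
  where
  open ≤-Reasoning
  shift : 4 * suc k + x ≡ (4 * k + x) + 4
  shift = solve (k ∷ x ∷ [])
  collect : 3 * s + (3 * w + z) ≡ 3 * (w + s) + z
  collect = solve (s ∷ w ∷ z ∷ [])

module _ {ψ : Potential} (potential : IsPotential ψ) where

  telescope : ∀ c → ValidWindows c → ∀ k p →
              4 * k + ψ (c k) (c (suc k)) (parityAfter k p)
                ≤ 3 * sum (applyUpTo (columnWeight ∘ c) k) + ψ (c 0) (c 1) p
  telescope c valid zero p = ≤-refl
  telescope c valid (suc k) p =
    telescope-step k _ (sum (applyUpTo (columnWeight ∘ c ∘ suc) k)) _ (columnWeight (c 0)) _
      (telescope (c ∘ suc) (valid ∘ suc) k (not p)) (potential _ _ _ p (valid 0))

  potential-bound : ∀ c → ValidWindows c → ∀ k → c k ≡ c 0 → c (suc k) ≡ c 1 → OddGap ψ (c 0) (c 1) →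
                    4 * k + 2 * (k % 2) ≤ 3 * sum (applyUpTo (columnWeight ∘ c) k)
  potential-bound c valid k c-k c-suc-k gap = +-cancelʳ-≤ (ψ₀ false) _ _ (begin
    4 * k + 2 * (k % 2) + ψ₀ false       ≡⟨ +-assoc (4 * k) _ _ ⟩
    4 * k + (2 * (k % 2) + ψ₀ false)     ≡⟨ cong (4 * k +_) (+-comm _ (ψ₀ false)) ⟩
    4 * k + (ψ₀ false + 2 * (k % 2))
      ≤⟨ +-monoʳ-≤ (4 * k) (oddGap-parityAfter {ψ} {c 0} {c 1} gap k) ⟩
    4 * k + ψ₀ (parityAfter k false)
      ≡⟨ cong₂ (λ a b → 4 * k + ψ a b (parityAfter k false)) c-k c-suc-k ⟨
    4 * k + ψ (c k) (c (suc k)) (parityAfter k false)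
      ≤⟨ telescope c valid k false ⟩
    3 * sum (applyUpTo (columnWeight ∘ c) k) + ψ₀ false ∎)
    where
    open ≤-Reasoning
    ψ₀ : Bool → ℕ
    ψ₀ = ψ (c 0) (c 1)

isPotential? : ∀ ψ → Dec (IsPotential ψ)
isPotential? ψ = ∀-column? λ a → ∀-column? λ b → ∀-column? λ c → ∀-bool? λ p →
  validWindow? a b c →-dec ψ b c (not p) + 4 ≤? 3 * columnWeight a + ψ a b p

oddGap? : ∀ ψ a b → Dec (OddGap ψ a b)
oddGap? ψ a b = ψ a b false + 2 ≤? ψ a b true

-- A table lists ψ (a , b , p) at position 9 · (3 x + y) + (3 u + v) for a = (x , y), b = (u , v).
fromTables : (even odd : Vec ℕ 81) → Potential
fromTables even odd (x , y) (u , v) false = Vec.lookup even (combine (combine x y) (combine u v))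
fromTables even odd (x , y) (u , v) true = Vec.lookup odd (combine (combine x y) (combine u v))

-- Shortest-path potentials for the edges (a , b , p) → (b , c , ¬ p) of length 3 w(a) − 4 over
-- the valid windows, computed offline with extra edges (x , true) → (x , false) of length −2
-- that force the odd gap; ψ₂ covers the ten pairs x at which ψ₁ has none.
ψ₁ : Potential
ψ₁ = fromTables
  (Vec.fromList
    ( 9 ∷  9 ∷  9 ∷  9 ∷  9 ∷  9 ∷  9 ∷  9 ∷  9 ∷
      9 ∷  9 ∷  9 ∷  6 ∷  6 ∷  6 ∷  5 ∷  5 ∷  5 ∷
      9 ∷  9 ∷  9 ∷  4 ∷  4 ∷  4 ∷  4 ∷  4 ∷  4 ∷
      9 ∷  8 ∷  7 ∷  9 ∷  8 ∷  7 ∷  9 ∷  4 ∷  3 ∷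
      3 ∷  5 ∷  5 ∷  3 ∷  3 ∷  3 ∷  3 ∷  3 ∷  3 ∷
      2 ∷  2 ∷  2 ∷  2 ∷  2 ∷  2 ∷  2 ∷  2 ∷  2 ∷
      9 ∷  6 ∷  6 ∷  9 ∷  6 ∷  2 ∷  9 ∷  2 ∷  2 ∷
      1 ∷  5 ∷  1 ∷  1 ∷  1 ∷  1 ∷  1 ∷  1 ∷  1 ∷
      0 ∷  0 ∷  0 ∷  0 ∷  0 ∷  0 ∷  0 ∷  0 ∷  0 ∷ []))
  (Vec.fromList
    (11 ∷ 11 ∷ 11 ∷ 11 ∷ 11 ∷ 11 ∷ 11 ∷ 11 ∷ 11 ∷
     11 ∷ 11 ∷ 11 ∷  8 ∷  8 ∷  8 ∷  7 ∷  7 ∷  7 ∷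
     11 ∷ 11 ∷ 11 ∷  6 ∷  6 ∷  6 ∷  6 ∷  6 ∷  6 ∷
     11 ∷  6 ∷  5 ∷ 11 ∷  6 ∷  5 ∷ 11 ∷  6 ∷  5 ∷
      5 ∷  5 ∷  5 ∷  5 ∷  5 ∷  5 ∷  5 ∷  5 ∷  5 ∷
      4 ∷  4 ∷  4 ∷  4 ∷  4 ∷  4 ∷  4 ∷  4 ∷  4 ∷
     11 ∷  4 ∷  4 ∷ 11 ∷  4 ∷  4 ∷ 11 ∷  4 ∷  4 ∷
      3 ∷  3 ∷  3 ∷  3 ∷  3 ∷  3 ∷  3 ∷  3 ∷  3 ∷
      2 ∷  2 ∷  2 ∷  2 ∷  2 ∷  2 ∷  2 ∷  2 ∷  2 ∷ []))

ψ₂ : Potential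
ψ₂ = fromTables
  (Vec.fromList
    ( 6 ∷  6 ∷  6 ∷  6 ∷  6 ∷  6 ∷  6 ∷  6 ∷  6 ∷
      6 ∷  6 ∷  6 ∷  5 ∷  5 ∷  5 ∷  4 ∷  4 ∷  4 ∷
      6 ∷  6 ∷  6 ∷  3 ∷  3 ∷  3 ∷  3 ∷  3 ∷  3 ∷
      6 ∷  3 ∷  2 ∷  6 ∷  3 ∷  2 ∷  6 ∷  3 ∷  2 ∷
      2 ∷  0 ∷  0 ∷  2 ∷  2 ∷  2 ∷  2 ∷  2 ∷  2 ∷
      2 ∷  2 ∷  2 ∷  2 ∷  2 ∷  2 ∷  2 ∷  2 ∷  2 ∷
      6 ∷  1 ∷  1 ∷  6 ∷  1 ∷  1 ∷  6 ∷  1 ∷  1 ∷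
      1 ∷  0 ∷  1 ∷  1 ∷  1 ∷  1 ∷  1 ∷  1 ∷  1 ∷
      1 ∷  1 ∷  1 ∷  1 ∷  1 ∷  1 ∷  1 ∷  1 ∷  1 ∷ []))
  (Vec.fromList
    ( 6 ∷  6 ∷  6 ∷  6 ∷  6 ∷  6 ∷  6 ∷  6 ∷  6 ∷
      6 ∷  6 ∷  6 ∷  3 ∷  3 ∷  3 ∷  2 ∷  2 ∷  2 ∷
      6 ∷  6 ∷  6 ∷  1 ∷  1 ∷  1 ∷  1 ∷  1 ∷  1 ∷
      6 ∷  5 ∷  4 ∷  6 ∷  5 ∷  4 ∷  6 ∷  5 ∷  4 ∷
      2 ∷  2 ∷  2 ∷  2 ∷  2 ∷  2 ∷  2 ∷  2 ∷  2 ∷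
      1 ∷  1 ∷  1 ∷  1 ∷  1 ∷  1 ∷  1 ∷  1 ∷  1 ∷
      6 ∷  3 ∷  3 ∷  6 ∷  3 ∷  3 ∷  6 ∷  3 ∷  3 ∷
      2 ∷  2 ∷  2 ∷  2 ∷  2 ∷  2 ∷  2 ∷  2 ∷  2 ∷
      1 ∷  1 ∷  1 ∷  1 ∷  1 ∷  1 ∷  1 ∷  1 ∷  1 ∷ []))

ψ₁-isPotential : IsPotential ψ₁
ψ₁-isPotential = from-yes (isPotential? ψ₁)

ψ₂-isPotential : IsPotential ψ₂
ψ₂-isPotential = from-yes (isPotential? ψ₂)

ψ₁-or-ψ₂-oddGap : ∀ a b → OddGap ψ₁ a b ⊎ OddGap ψ₂ a b
ψ₁-or-ψ₂-oddGap = from-yes (∀-column? λ a → ∀-column? λ b → oddGap? ψ₁ a b ⊎-dec oddGap? ψ₂ a b)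

cyclic-weight-bound : ∀ c → ValidWindows c → ∀ k → c k ≡ c 0 → c (suc k) ≡ c 1 →
                      4 * k + 2 * (k % 2) ≤ 3 * sum (applyUpTo (columnWeight ∘ c) k)
cyclic-weight-bound c valid k c-k c-suc-k =
  [ potential-bound ψ₁-isPotential c valid k c-k c-suc-k
  , potential-bound ψ₂-isPotential c valid k c-k c-suc-k
  ]′ (ψ₁-or-ψ₂-oddGap (c 0) (c 1))

-- The graph P₂ □ Cₘ

module Prism (n : ℕ) where

  m : ℕ
  m = suc n

  at : ℕ → Fin m
  at j = j mod m

  toℕ-at : ∀ j → toℕ (at j) ≡ j % m
  toℕ-at j = toℕ-fromℕ< (m%n<n j m)

  at-≡ : ∀ i j → i % m ≡ j % m → at i ≡ at j
  at-≡ i j e = toℕ-injective (trans (toℕ-at i) (trans e (sym (toℕ-at j))))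

  at-toℕ : ∀ x → at (toℕ x) ≡ x
  at-toℕ x = toℕ-injective (trans (toℕ-at (toℕ x)) (m<n⇒m%n≡m (toℕ<n x)))

  at-periodic : ∀ i → at (m + i) ≡ at i
  at-periodic i = at-≡ (m + i) i (%-remove-+ˡ i ∣-refl)

  %-absorbʳ : ∀ a b → (a + b % m) % m ≡ (a + b) % m
  %-absorbʳ a b = begin
    (a + b % m) % m           ≡⟨ %-distribˡ-+ a (b % m) m ⟩
    (a % m + b % m % m) % m   ≡⟨ cong (λ t → (a % m + t) % m) (m%n%n≡m%n b m) ⟩
    (a % m + b % m) % m       ≡⟨ %-distribˡ-+ a b m ⟨
    (a + b) % m               ∎
    where open ≡-Reasoning

  at-+% : ∀ i j → at (i + j % m) ≡ at (i + j)
  at-+% i j = at-≡ (i + j % m) (i + j) (%-absorbʳ i j)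

  next : ∀ j → toℕ (at (suc j)) ≡ suc (toℕ (at j)) % m
  next j = trans (toℕ-at (suc j)) (sym (trans (cong (λ t → suc t % m) (toℕ-at j)) (%-absorbʳ 1 j)))

  pred-% : ∀ a → (suc a % m + n) % m ≡ a % m
  pred-% a = begin
    (suc a % m + n) % m   ≡⟨ cong (_% m) (+-comm (suc a % m) n) ⟩
    (n + suc a % m) % m   ≡⟨ %-absorbʳ n (suc a) ⟩
    (n + suc a) % m       ≡⟨ cong (_% m) (+-suc n a) ⟩
    (m + a) % m           ≡⟨ %-remove-+ˡ a ∣-refl ⟩
    a % m                 ∎
    where open ≡-Reasoning

  suc-%-injective : ∀ {a b} → a < m → b < m → suc a % m ≡ suc b % m → a ≡ b
  suc-%-injective {a} {b} a<m b<m e = begin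
    a                     ≡⟨ m<n⇒m%n≡m a<m ⟨
    a % m                 ≡⟨ pred-% a ⟨
    (suc a % m + n) % m   ≡⟨ cong (λ t → (t + n) % m) e ⟩
    (suc b % m + n) % m   ≡⟨ pred-% b ⟩
    b % m                 ≡⟨ m<n⇒m%n≡m b<m ⟩
    b                     ∎
    where open ≡-Reasoning

  left-adj : ∀ r j → Adj 2 m (r , at (suc j)) (r , at j)
  left-adj r j = cyc- (next j)

  right-adj : ∀ r j → Adj 2 m (r , at (suc j)) (r , at (suc (suc j)))
  right-adj r j = cyc+ (next (suc j))

  across-adj : ∀ r x → Adj 2 m (r , x) (otherRow r , x)
  across-adj zero x = path+ refl
  across-adj (suc zero) x = path- refl

  neighbour-cases : ∀ {P : Vertex 2 m → Set} {r j v} → Adj 2 m (r , at (suc j)) v → P v →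
                    P (r , at j) ⊎ P (r , at (suc (suc j))) ⊎ P (otherRow r , at (suc j))
  neighbour-cases {P} {r} {j} (cyc+ {j' = x} e) p =
    inj₂ (inj₁ (subst (λ y → P (r , y)) (toℕ-injective (trans e (sym (next (suc j))))) p))
  neighbour-cases {P} {r} {j} (cyc- {j' = x} e) p =
    inj₁ (subst (λ y → P (r , y)) x≡at-j p)
    where
    x≡at-j : x ≡ at j
    x≡at-j = toℕ-injective (suc-%-injective (toℕ<n x) (toℕ<n (at j)) (trans (sym e) (next j)))
  neighbour-cases {r = zero} (path+ {i' = suc zero} _) p = inj₂ (inj₂ p)
  neighbour-cases {r = suc zero} (path- {i' = zero} _) p = inj₂ (inj₂ p)

  centre : ∀ x → at (suc (n + toℕ x)) ≡ x
  centre x = trans (at-periodic (toℕ x)) (at-toℕ x)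

  Dominated Independent : Labelling 2 m → Vertex 2 m → Set
  Dominated f u = toℕ (f u) ≡ 0 → ∃ λ v → Adj 2 m u v × toℕ (f v) ≡ 2
  Independent f u = ∀ v → Adj 2 m u v → toℕ (f u) ≡ 0 → toℕ (f v) ≢ 0

  column : Labelling 2 m → Fin m → Column
  column f x = f (zero , x) , f (suc zero , x)

  columns : Labelling 2 m → ℕ → Column
  columns f = column f ∘ at

  module _ {f : Labelling 2 m} (r : Fin 2) (j : ℕ) where

    LocalOIR-at : Set
    LocalOIR-at = LocalOIR (f (r , at j)) (f (r , at (suc j))) (f (r , at (suc (suc j))))
                           (f (otherRow r , at (suc j)))

    oirdf⇒localOIR : IsOIRDF 2 m f → LocalOIR-at
    oirdf⇒localOIR (dominated , independent) x≡0 =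
      (nonzero (left-adj r j) , nonzero (right-adj r j) , nonzero (across-adj r _)) , two
      where
      nonzero : ∀ {v} → Adj 2 m (r , at (suc j)) v → toℕ (f v) ≢ 0
      nonzero a = independent _ _ a x≡0
      two : toℕ (f (r , at j)) ≡ 2 ⊎ toℕ (f (r , at (suc (suc j)))) ≡ 2
              ⊎ toℕ (f (otherRow r , at (suc j))) ≡ 2
      two = let (v , a , v≡2) = dominated _ x≡0 in neighbour-cases {P = λ u → toℕ (f u) ≡ 2} a v≡2

    localOIR⇒oirdf : LocalOIR-at → Dominated f (r , at (suc j)) × Independent f (r , at (suc j))
    localOIR⇒oirdf local = dominated , independent
      where
      dominated : Dominated f (r , at (suc j))
      dominated x≡0 with proj₂ (local x≡0)
      ... | inj₁ e = _ , left-adj r j , e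
      ... | inj₂ (inj₁ e) = _ , right-adj r j , e
      ... | inj₂ (inj₂ e) = _ , across-adj r _ , e
      independent : Independent f (r , at (suc j))
      independent v a x≡0 v≡0 with proj₁ (local x≡0) | neighbour-cases {P = λ u → toℕ (f u) ≡ 0} a v≡0
      ... | l≢0 , _ , _ | inj₁ e = l≢0 e
      ... | _ , r≢0 , _ | inj₂ (inj₁ e) = r≢0 e
      ... | _ , _ , o≢0 | inj₂ (inj₂ e) = o≢0 e

  oirdf⇒validWindows : ∀ {f} → IsOIRDF 2 m f → ValidWindows (columns f)
  oirdf⇒validWindows h j zero = oirdf⇒localOIR zero j h
  oirdf⇒validWindows h j (suc zero) = oirdf⇒localOIR (suc zero) j h

  validWindows⇒oirdf : ∀ {f} → ValidWindows (columns f) → IsOIRDF 2 m f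
  validWindows⇒oirdf {f} valid = proj₁ ∘ local , proj₂ ∘ local
    where
    rowOf : ∀ {j} → ValidWindow (columns f j) (columns f (suc j)) (columns f (suc (suc j))) →
            ∀ r → LocalOIR-at {f} r j
    rowOf v zero = v zero
    rowOf v (suc zero) = v (suc zero)
    local : ∀ u → Dominated f u × Independent f u
    local (r , x) = subst (λ y → Dominated f (r , y) × Independent f (r , y)) (centre x)
                      (localOIR⇒oirdf r (n + toℕ x) (rowOf (valid (n + toℕ x)) r))

  weight≡sum-columns : ∀ f → weight 2 m f ≡ sum (map (columnWeight ∘ column f) (allFin m))
  weight≡sum-columns f = begin
    weight 2 m f
      ≡⟨ cong (sum (map (label zero) (allFin m)) +_) (+-identityʳ _) ⟩
    sum (map (label zero) (allFin m)) + sum (map (label (suc zero)) (allFin m))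
      ≡⟨ sum-map-+ (label zero) (label (suc zero)) (allFin m) ⟨
    sum (map (columnWeight ∘ column f) (allFin m)) ∎
    where
    open ≡-Reasoning
    label : Fin 2 → Fin m → ℕ
    label r x = toℕ (f (r , x))

  sum-allFin : ∀ (g : Fin m → ℕ) → sum (map g (allFin m)) ≡ sum (applyUpTo (g ∘ at) m)
  sum-allFin g = cong sum (begin
    map g (allFin m)           ≡⟨ map-tabulate (λ x → x) g ⟩
    tabulate g                 ≡⟨ tabulate-cong (λ x → cong g (sym (at-toℕ x))) ⟩
    tabulate (g ∘ at ∘ toℕ)    ≡⟨ tabulate-toℕ m (g ∘ at) ⟩
    applyUpTo (g ∘ at) m       ∎)
    where open ≡-Reasoning

  oirdf-weight-bound : ∀ f → IsOIRDF 2 m f → 4 * m + 2 * (m % 2) ≤ 3 * weight 2 m f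
  oirdf-weight-bound f h = subst (λ w → 4 * m + 2 * (m % 2) ≤ 3 * w) (sym weight≡)
    (cyclic-weight-bound (columns f) (oirdf⇒validWindows h) m
      (cong (column f) (at-≡ m 0 (n%n≡0 m))) (cong (column f) (at-≡ (suc m) 1 ([m+n]%n≡m%n 1 m))))
    where
    weight≡ : weight 2 m f ≡ sum (applyUpTo (columnWeight ∘ columns f) m)
    weight≡ = trans (weight≡sum-columns f) (sum-allFin (columnWeight ∘ column f))

-- Arithmetic of the claimed value

ceil4m/3-+6 : ∀ k → ceil4m/3 (6 + k) ≡ 8 + ceil4m/3 k
ceil4m/3-+6 k = begin
  (4 * (6 + k) + 2) / 3    ≡⟨ cong (_/ 3) expand ⟩
  (24 + (4 * k + 2)) / 3   ≡⟨ +-distrib-/-∣ˡ {24} (4 * k + 2) {3} (divides 8 refl) ⟩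
  8 + ceil4m/3 k           ∎
  where
  open ≡-Reasoning
  expand : 4 * (6 + k) + 2 ≡ 24 + (4 * k + 2)
  expand = solve (k ∷ [])

oiRValue-+6 : ∀ k → oiRValue (6 + k) ≡ 8 + oiRValue k
oiRValue-+6 k with k % 6
... | 0 = ceil4m/3-+6 k
... | 1 = ceil4m/3-+6 k
... | 2 = ceil4m/3-+6 k
... | 3 = cong (_+ 1) (ceil4m/3-+6 k)
... | 4 = ceil4m/3-+6 k
... | 5 = cong (_+ 1) (ceil4m/3-+6 k)
... | suc (suc (suc (suc (suc (suc _))))) = ceil4m/3-+6 k

3*oiRValue≤ : ∀ m → 3 * oiRValue m ≤ 4 * m + 2 * (m % 2) + 2
3*oiRValue≤ 0 = ≤ᵇ⇒≤ _ _ tt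
3*oiRValue≤ 1 = ≤ᵇ⇒≤ _ _ tt
3*oiRValue≤ 2 = ≤ᵇ⇒≤ _ _ tt
3*oiRValue≤ 3 = ≤ᵇ⇒≤ _ _ tt
3*oiRValue≤ 4 = ≤ᵇ⇒≤ _ _ tt
3*oiRValue≤ 5 = ≤ᵇ⇒≤ _ _ tt
3*oiRValue≤ (suc (suc (suc (suc (suc (suc k)))))) = begin
  3 * oiRValue (6 + k)             ≡⟨ cong (3 *_) (oiRValue-+6 k) ⟩
  3 * (8 + oiRValue k)             ≡⟨ *-distribˡ-+ 3 8 (oiRValue k) ⟩
  24 + 3 * oiRValue k              ≤⟨ +-monoʳ-≤ 24 (3*oiRValue≤ k) ⟩
  24 + (4 * k + 2 * (k % 2) + 2)   ≡⟨ shift (2 * (k % 2)) ⟩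
  4 * (6 + k) + 2 * (k % 2) + 2    ∎
  where
  open ≤-Reasoning
  shift : ∀ b → 24 + (4 * k + b + 2) ≡ 4 * (6 + k) + b + 2
  shift b = solve (k ∷ b ∷ [])

3a≤3b+2⇒a≤b : ∀ a b → 3 * a ≤ 3 * b + 2 → a ≤ b
3a≤3b+2⇒a≤b a b h = m<1+n⇒m≤n (*-cancelˡ-< 3 a (suc b) (≤-trans (s≤s h) (≤-reflexive round-up)))
  where
  round-up : suc (3 * b + 2) ≡ 3 * suc b
  round-up = solve (b ∷ [])

oiRValue≤weight : ∀ n f → IsOIRDF 2 (suc n) f → oiRValue (suc n) ≤ weight 2 (suc n) f
oiRValue≤weight n f h = 3a≤3b+2⇒a≤b _ _ (begin
  3 * oiRValue m                 ≤⟨ 3*oiRValue≤ m ⟩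
  4 * m + 2 * (m % 2) + 2        ≤⟨ +-monoˡ-≤ 2 (oirdf-weight-bound f h) ⟩
  3 * weight 2 m f + 2           ∎)
  where
  open Prism n
  open ≤-Reasoning

-- Optimal labellings

Windows : List Column → Set
Windows (a ∷ b ∷ c ∷ cs) = ValidWindow a b c × Windows (b ∷ c ∷ cs)
Windows _ = ⊤

windows? : ∀ cs → Dec (Windows cs)
windows? (a ∷ b ∷ c ∷ cs) = validWindow? a b c ×-dec windows? (b ∷ c ∷ cs)
windows? [] = yes tt
windows? (_ ∷ []) = yes tt
windows? (_ ∷ _ ∷ []) = yes tt

windows-++ : ∀ xs {a b} ys → Windows (xs ++ a ∷ b ∷ []) → Windows (a ∷ b ∷ ys) →
             Windows (xs ++ a ∷ b ∷ ys)
windows-++ [] ys _ w = w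
windows-++ (x ∷ []) ys (v , _) w = v , w
windows-++ (x ∷ y ∷ []) ys (v , v′ , _) w = v , v′ , w
windows-++ (x ∷ y ∷ z ∷ zs) ys (v , vs) w = v , windows-++ (y ∷ z ∷ zs) ys vs w

Reads : (ℕ → Column) → List Column → Set
Reads t [] = ⊤
Reads t (x ∷ xs) = t 0 ≡ x × Reads (t ∘ suc) xs

reads-++ : ∀ {t} xs {ys} → Reads t xs → Reads (t ∘ (length xs +_)) ys → Reads t (xs ++ ys)
reads-++ [] _ r = r
reads-++ (x ∷ xs) (e , r) r′ = e , reads-++ xs r r′

reads-lookup : ∀ {t} xs → (∀ i → t (toℕ i) ≡ lookup xs i) → Reads t xs
reads-lookup [] _ = tt
reads-lookup (x ∷ xs) e = e zero , reads-lookup xs (e ∘ suc)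

reads⇒windows : ∀ {t a b} xs → Reads t (a ∷ b ∷ xs) → Windows (a ∷ b ∷ xs) →
                ∀ k → k < length xs → ValidWindow (t k) (t (suc k)) (t (suc (suc k)))
reads⇒windows (c ∷ cs) (refl , refl , refl , _) (v , _) zero _ = v
reads⇒windows {t} (c ∷ cs) (_ , r) (_ , w) (suc k) (s≤s k<) = reads⇒windows {t ∘ suc} cs r w k k<

module Cyclic (a b : Column) (rest : List Column) where

  open Prism (suc (length rest))

  cycle : List Column
  cycle = a ∷ b ∷ rest

  labelling : Labelling 2 m
  labelling (r , x) = row r (lookup cycle x)

  closed⇒oirdf : Windows (cycle ++ a ∷ b ∷ []) → IsOIRDF 2 m labelling
  closed⇒oirdf closed = validWindows⇒oirdf valid
    where
    letter : ℕ → Column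
    letter = lookup cycle ∘ at
    reads : Reads letter (cycle ++ a ∷ b ∷ [])
    reads = reads-++ {letter} cycle (reads-lookup {letter} cycle (cong (lookup cycle) ∘ at-toℕ))
              (cong (lookup cycle) (at-periodic 0) , cong (lookup cycle) (at-periodic 1) , tt)
    length-closed : length (rest ++ a ∷ b ∷ []) ≡ m
    length-closed = trans (length-++ rest) (+-comm (length rest) 2)
    valid : ValidWindows letter
    valid j =
      ValidWindow-cong (cong (lookup cycle) (at-+% 0 j)) (cong (lookup cycle) (at-+% 1 j))
                       (cong (lookup cycle) (at-+% 2 j))
        (reads⇒windows {letter} _ reads closed (j % m)
          (subst (j % m <_) (sym length-closed) (m%n<n j m)))

  weight-labelling : weight 2 m labelling ≡ sum (map columnWeight cycle)
  weight-labelling = trans (weight≡sum-columns labelling) (cong sum (begin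
    map (columnWeight ∘ lookup cycle) (allFin m)   ≡⟨ map-tabulate (λ x → x) _ ⟩
    tabulate (columnWeight ∘ lookup cycle)         ≡⟨ map-tabulate (lookup cycle) columnWeight ⟨
    map columnWeight (tabulate (lookup cycle))     ≡⟨ cong (map columnWeight) (tabulate-lookup cycle) ⟩
    map columnWeight cycle                         ∎))
    where open ≡-Reasoning

s₀ s₁ : Column
s₀ = # 0 , # 1
s₁ = # 2 , # 0

blockTail : List Column
blockTail = (# 0 , # 1) ∷ (# 1 , # 0) ∷ (# 0 , # 2) ∷ (# 1 , # 0) ∷ []

optimalTail : ℕ → List Column
optimalTail 0 = (# 1 , # 1) ∷ []
optimalTail 1 = (# 0 , # 1) ∷ (# 1 , # 1) ∷ []
optimalTail 2 = (# 0 , # 1) ∷ (# 1 , # 0) ∷ (# 1 , # 2) ∷ []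
optimalTail 3 = blockTail
optimalTail 4 = blockTail ++ (# 1 , # 1) ∷ []
optimalTail 5 = blockTail ++ s₀ ∷ s₁ ∷ []
optimalTail (suc (suc (suc (suc (suc (suc k)))))) = blockTail ++ s₀ ∷ s₁ ∷ optimalTail k

optimalWord : ℕ → List Column
optimalWord k = s₀ ∷ s₁ ∷ optimalTail k

closedOptimalWord : ℕ → List Column
closedOptimalWord k = optimalWord k ++ s₀ ∷ s₁ ∷ []

optimalWord-length : ∀ k → length (optimalWord k) ≡ 3 + k
optimalWord-length 0 = refl
optimalWord-length 1 = refl
optimalWord-length 2 = refl
optimalWord-length 3 = refl
optimalWord-length 4 = refl
optimalWord-length 5 = refl
optimalWord-length (suc (suc (suc (suc (suc (suc k)))))) = cong (6 +_) (optimalWord-length k)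

optimalWord-weight : ∀ k → sum (map columnWeight (optimalWord k)) ≡ oiRValue (3 + k)
optimalWord-weight 0 = refl
optimalWord-weight 1 = refl
optimalWord-weight 2 = refl
optimalWord-weight 3 = refl
optimalWord-weight 4 = refl
optimalWord-weight 5 = refl
optimalWord-weight (suc (suc (suc (suc (suc (suc k)))))) =
  trans (cong (8 +_) (optimalWord-weight k)) (sym (oiRValue-+6 (3 + k)))

optimalWord-closed : ∀ k → Windows (closedOptimalWord k)
optimalWord-closed 0 = from-yes (windows? (closedOptimalWord 0))
optimalWord-closed 1 = from-yes (windows? (closedOptimalWord 1))
optimalWord-closed 2 = from-yes (windows? (closedOptimalWord 2))
optimalWord-closed 3 = from-yes (windows? (closedOptimalWord 3))
optimalWord-closed 4 = from-yes (windows? (closedOptimalWord 4))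
optimalWord-closed 5 = from-yes (windows? (closedOptimalWord 5))
optimalWord-closed (suc (suc (suc (suc (suc (suc k)))))) =
  windows-++ (optimalWord 3) _ (optimalWord-closed 3) (optimalWord-closed k)

OIRDFOfWeight : ℕ → ℕ → Set
OIRDFOfWeight m w = Σ (Labelling 2 m) λ f → IsOIRDF 2 m f × weight 2 m f ≡ w

optimal-labelling : ∀ k → OIRDFOfWeight (3 + k) (oiRValue (3 + k))
optimal-labelling k =
  subst (λ m → OIRDFOfWeight m (oiRValue (3 + k))) (optimalWord-length k)
    (labelling , closed⇒oirdf (optimalWord-closed k) , trans weight-labelling (optimalWord-weight k))
  where open Cyclic s₀ s₁ (optimalTail k)

theorem2 : (m : ℕ) → 3 ≤ m → IsγoiR 2 m (oiRValue m)
theorem2 (suc (suc (suc k))) _ = optimal-labelling k , oiRValue≤weight (2 + k)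
theorem2 (suc (suc zero)) (s≤s (s≤s ()))
theorem2 (suc zero) (s≤s ())
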